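{- Let $H$ be a graph, let $r\ge0$, let $P$ be a path graph with vertices $x_0,x_1,\dots,x_{r+1}$ (in this order), and let $w\in V(H)$. If every vertex of $H$ within distance $r-1$ of $w$ has odd degree, then $|\mathrm{Hom}((P,x_0),(H,w))|$ has opposite parity to the number of distinct paths of length $r$ in $H$ that start at $w$ and end at a vertex of even degree.
   Context: Graphs are finite, simple, undirected, loopless; paths do not repeat vertices and the length of a path is its number of edges (a path of length $0$ is a single vertex). $\mathrm{Hom}((P,x_0),(H,w))$ is the set of graph homomorphisms $\sigma:P\to H$ (edges to edges) with $\sigma(x_0)=w$. Degree $0$ counts as even. -}

module Defs where

open import Data.Nat using (ℕ; zero; suc; _+_; _<_; _≤_; _∸_) renaming (_≟_ to _ℕ≟_)
open import Data.Nat.Properties using (1+n≢n)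
open import Data.Bool.Properties using (∨-comm)
open import Data.Empty using (⊥-elim)
open import Relation.Nullary using (yes; no)
open import Data.Nat.DivMod using (_%_)
open import Data.Bool using (Bool; true; false; _∧_; _∨_; not; if_then_else_; T)
open import Data.Fin using (Fin; zero; suc; toℕ; _≟_; inject₁)
open import Data.Vec using (Vec; []; _∷_; lookup; head; last; toList)
open import Data.List as List using (List; allFin; map)
open import Data.Bool.ListAction using (all)
open import Data.Nat.ListAction using (sum)
open import Data.Product using (Σ; _×_; ∃; proj₁)
open import Relation.Nullary.Decidable using (⌊_⌋)
open import Relation.Binary.PropositionalEquality as Eq using (_≡_; refl; cong₂)

record Graph : Set where
  field
    n      : ℕ
    adj    : Fin n → Fin n → Bool
    symm   : ∀ u v → adj u v ≡ adj v u
    irrefl : ∀ v → adj v v ≡ false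
open Graph public

deg : (G : Graph) → Fin (n G) → ℕ
deg G v = sum (map (λ u → if adj G v u then 1 else 0) (allFin (n G)))

Even : ℕ → Set
Even m = m % 2 ≡ 0

Odd : ℕ → Set
Odd m = m % 2 ≡ 1

-- The path graph P with r+2 vertices x₀,…,x_{r+1} (vertex xᵢ is i : Fin (r+2));
-- its edges are exactly the pairs {xᵢ, xᵢ₊₁}.
succB : ℕ → ℕ → Bool
succB a b = ⌊ suc a ℕ≟ b ⌋

pathAdj : (k : ℕ) → Fin k → Fin k → Bool
pathAdj k i j = succB (toℕ i) (toℕ j) ∨ succB (toℕ j) (toℕ i)

succB-irrefl : ∀ a → succB a a ≡ false
succB-irrefl a with suc a ℕ≟ a
... | yes p = ⊥-elim (1+n≢n p)
... | no _  = refl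

pathGraph : ℕ → Graph
pathGraph k = record
  { n = k
  ; adj = pathAdj k
  ; symm = λ i j → ∨-comm (succB (toℕ i) (toℕ j)) (succB (toℕ j) (toℕ i))
  ; irrefl = λ i → cong₂ _∨_ (succB-irrefl (toℕ i)) (succB-irrefl (toℕ i))
  }

isHom : (G H : Graph) → Vec (Fin (n H)) (n G) → Bool
isHom G H σ =
  all (λ i → all (λ j → not (adj G i j) ∨ adj H (lookup σ i) (lookup σ j))
                 (allFin (n G)))
      (allFin (n G))

Hom : (G : Graph) (x₀ : Fin (n G)) (H : Graph) (w : Fin (n H)) → Set
Hom G x₀ H w = Σ (Vec (Fin (n H)) (n G)) λ σ → T (isHom G H σ ∧ ⌊ lookup σ x₀ ≟ w ⌋)

consecAdj : (H : Graph) → {k : ℕ} → Vec (Fin (n H)) k → Bool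
consecAdj H [] = true
consecAdj H (u ∷ []) = true
consecAdj H (u ∷ v ∷ vs) = adj H u v ∧ consecAdj H (v ∷ vs)

notIn : {m k : ℕ} → Fin m → Vec (Fin m) k → Bool
notIn x [] = true
notIn x (y ∷ ys) = not ⌊ x ≟ y ⌋ ∧ notIn x ys

distinct : {m k : ℕ} → Vec (Fin m) k → Bool
distinct [] = true
distinct (x ∷ xs) = notIn x xs ∧ distinct xs

-- A path of length k in H starting at w, given by its vertex sequence
-- v₀ = w, v₁, …, v_k (distinct vertices, consecutive ones adjacent).
isPathFrom : (H : Graph) (w : Fin (n H)) {k : ℕ} → Vec (Fin (n H)) (suc k) → Bool
isPathFrom H w p = ⌊ head p ≟ w ⌋ ∧ consecAdj H p ∧ distinct p

PathFrom : (H : Graph) (w : Fin (n H)) (k : ℕ) → Set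
PathFrom H w k = Σ (Vec (Fin (n H)) (suc k)) λ p → T (isPathFrom H w p)

EvenEndPath : (H : Graph) (w : Fin (n H)) (k : ℕ) → Set
EvenEndPath H w k =
  Σ (Vec (Fin (n H)) (suc k)) λ p →
    T (isPathFrom H w p ∧ ⌊ deg H (last p) % 2 ℕ≟ 0 ⌋)

-- dist(w,v) ≤ r - 1 over the integers, i.e. dist(w,v) < r
-- (for r = 0 no vertex qualifies).
WithinDistPred : (H : Graph) (w v : Fin (n H)) (r : ℕ) → Set
WithinDistPred H w v r = Σ ℕ λ k → k < r × Σ (PathFrom H w k) λ p → last (proj₁ p) ≡ v

module Submission where

-- Let W_m(v) be the number of walks of length m from v; the homomorphisms (P, x₀) → (H, w) are the
-- walks of length r + 1 from w. Given a path w = v₀, …, v_j = v with j + m = r, let E_m(v) count its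
-- continuations by m further vertices that end at a vertex of even degree. By induction on m,
-- W_{m+1}(v) ≡ 1 + E_m(v) (mod 2). For m = 0 this is deg v ≡ 1 + [deg v even]. Otherwise write
-- W_{m+1}(v) = Σ_{u ~ v} W_m(u): a neighbour u off the path contributes 1 + E_{m-1}(u), while a
-- neighbour on the path is closer to w, so all vertices within m - 1 steps of u have odd degree and
-- W_m(u) is odd. Hence W_{m+1}(v) ≡ deg v + E_m(v), and deg v is odd because j < r.

open import Defs
open import Data.Bool using (Bool; true; false; T; not; _∧_; _∨_; if_then_else_)
open import Data.Bool.ListAction using (all)
open import Data.Bool.Properties using (T-∧; T-∨; ∧-assoc; ∧-comm; ∧-identityʳ; ∧-commutativeMonoid)
open import Algebra.Solver.CommutativeMonoid ∧-commutativeMonoid using (solve; _⊕_; _⊜_)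
open import Data.Empty using (⊥-elim)
open import Data.Fin using (Fin; zero; suc; toℕ; _≟_)
open import Data.Fin.Permutation using (↔⇒≡)
open import Data.Fin.Properties using (+↔⊎)
open import Data.List using (List; []; _∷_; allFin; tabulate)
open import Data.List.Membership.Propositional.Properties using (∈-allFin)
open import Data.List.Properties using (map-tabulate)
open import Data.List.Relation.Unary.All as All using ()
open import Data.List.Relation.Unary.All.Properties using (all⁺; all⁻)
open import Data.Nat using (ℕ; zero; suc; _+_; _≤_; _<_; z≤n; s≤s; parity) renaming (_≟_ to _ℕ≟_)
open import Data.Nat.DivMod using (_%_; [m+n]%n≡m%n)
import Data.Nat.ListAction as List
open import Data.Nat.Properties
  using (+-0-monoid; +-comm; +-suc; +-identityʳ; +-monoˡ-≤; ≤-refl; ≤-reflexive; ≤-trans; n≤1+n; m≤m+n; suc-injective)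
open import Data.Parity.Base as ℙ using (Parity; 0ℙ; 1ℙ; _⁻¹)
open import Data.Parity.Properties using (+-homo-+; p⁻¹+p≡1ℙ; +-0-commutativeMonoid)
open import Algebra.Properties.Monoid.Sum +-0-monoid using (sum; sum-syntax; sum-cong-≗; sum-replicate-zero)
import Algebra.Properties.CommutativeMonoid.Sum +-0-commutativeMonoid as ℙ∑
open import Data.Product using (Σ; _×_; _,_; proj₁; proj₂)
open import Data.Product.Function.Dependent.Propositional using (congˡ)
open import Data.Sum as Sum using (_⊎_; inj₁; inj₂)
open import Data.Sum.Function.Propositional using (_⊎-cong_)
open import Data.Unit using (tt)
open import Data.Vec using (Vec; []; _∷_; _∷ʳ_; head; last; lookup)
open import Data.Vec.Properties using (last-∷ʳ)
open import Function using (_∘_; case_of_)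
open import Function.Bundles using (_↔_; _⇔_; mk⇔; mk↔ₛ′; Equivalence)
open import Function.Properties.Inverse using (↔-refl; ↔-sym; ↔-trans)
open import Relation.Binary.PropositionalEquality using (_≡_; refl; sym; trans; cong; cong₂; subst; module ≡-Reasoning)
open import Relation.Nullary.Decidable using (⌊_⌋; yes; no; toWitness; fromWitness)

↔Fin-unique : ∀ {A : Set} {a b} → A ↔ Fin a → A ↔ Fin b → a ≡ b
↔Fin-unique A↔a A↔b = ↔⇒≡ (↔-trans (↔-sym A↔a) A↔b)

T↔Fin : ∀ b → T b ↔ Fin (if b then 1 else 0)
T↔Fin true  = mk↔ₛ′ (λ _ → zero) (λ _ → tt) (λ { zero → refl }) (λ _ → refl)
T↔Fin false = mk↔ₛ′ (λ ()) (λ ()) (λ ()) (λ ())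

Σ-Fin-suc↔ : ∀ {N} (B : Fin (suc N) → Set) → Σ (Fin (suc N)) B ↔ (B zero ⊎ Σ (Fin N) (B ∘ suc))
Σ-Fin-suc↔ B = mk↔ₛ′ split join split∘join join∘split
  where
  split : Σ _ B → _
  split (zero  , b) = inj₁ b
  split (suc x , b) = inj₂ (x , b)
  join : _ → Σ _ B
  join (inj₁ b)       = zero , b
  join (inj₂ (x , b)) = suc x , b
  split∘join : ∀ y → split (join y) ≡ y
  split∘join (inj₁ b)       = refl
  split∘join (inj₂ (x , b)) = refl
  join∘split : ∀ y → join (split y) ≡ y
  join∘split (zero  , b) = refl
  join∘split (suc x , b) = refl

Σ-Fin↔Fin-∑ : ∀ {N} (c : Fin N → ℕ) → Σ (Fin N) (Fin ∘ c) ↔ Fin (∑[ x < N ] c x)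
Σ-Fin↔Fin-∑ {zero}  c = mk↔ₛ′ (λ { (() , _) }) (λ ()) (λ ()) (λ { (() , _) })
Σ-Fin↔Fin-∑ {suc N} c =
  ↔-trans (Σ-Fin-suc↔ (Fin ∘ c)) (↔-trans (↔-refl ⊎-cong Σ-Fin↔Fin-∑ (c ∘ suc)) (↔-sym +↔⊎))

Σ-Vec-[]↔ : ∀ {A : Set} (P : Vec A 0 → Set) → Σ (Vec A 0) P ↔ P []
Σ-Vec-[]↔ P = mk↔ₛ′ (λ { ([] , p) → p }) ([] ,_) (λ _ → refl) (λ { ([] , p) → refl })

Σ-Vec-∷↔ : ∀ {A : Set} {k} (P : Vec A (suc k) → Set) →
           Σ (Vec A (suc k)) P ↔ Σ A (λ x → Σ (Vec A k) (P ∘ (x ∷_)))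
Σ-Vec-∷↔ P = mk↔ₛ′ (λ { (x ∷ xs , p) → x , xs , p }) (λ { (x , xs , p) → x ∷ xs , p })
                   (λ _ → refl) (λ { (x ∷ xs , p) → refl })

≟-suc : ∀ {N} (x w : Fin N) → ⌊ suc x ≟ suc w ⌋ ≡ ⌊ x ≟ w ⌋
≟-suc x w with x ≟ w
... | yes _ = refl
... | no  _ = refl

∑-if-≟ : ∀ {N} (w : Fin N) (f : Fin N → ℕ) → ∑[ x < N ] (if ⌊ x ≟ w ⌋ then f x else 0) ≡ f w
∑-if-≟ {suc N} zero    f = trans (cong (f zero +_) (sum-replicate-zero N)) (+-identityʳ (f zero))
∑-if-≟ {suc N} (suc w) f =
  trans (sum-cong-≗ {N} (λ x → cong (λ b → if b then f (suc x) else 0) (≟-suc x w))) (∑-if-≟ w (f ∘ suc))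

sum-tabulate : ∀ {N} (f : Fin N → ℕ) → List.sum (tabulate f) ≡ ∑[ x < N ] f x
sum-tabulate {zero}  f = refl
sum-tabulate {suc N} f = cong (f zero +_) (sum-tabulate (f ∘ suc))

module _ {N : ℕ} where

  count : ∀ k → (Vec (Fin N) k → Bool) → ℕ
  count zero    P = if P [] then 1 else 0
  count (suc k) P = ∑[ x < N ] count k (P ∘ (x ∷_))

  Σ-Vec↔Fin-count : ∀ k (P : Vec (Fin N) k → Bool) → Σ (Vec (Fin N) k) (T ∘ P) ↔ Fin (count k P)
  Σ-Vec↔Fin-count zero    P = ↔-trans (Σ-Vec-[]↔ _) (T↔Fin (P []))
  Σ-Vec↔Fin-count (suc k) P =
    ↔-trans (Σ-Vec-∷↔ _) (↔-trans (congˡ (λ {x} → Σ-Vec↔Fin-count k (P ∘ (x ∷_)))) (Σ-Fin↔Fin-∑ _))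

  count-cong : ∀ k {P Q : Vec (Fin N) k → Bool} → (∀ xs → P xs ≡ Q xs) → count k P ≡ count k Q
  count-cong zero    P≗Q = cong (λ b → if b then 1 else 0) (P≗Q [])
  count-cong (suc k) P≗Q = sum-cong-≗ (λ x → count-cong k (P≗Q ∘ (x ∷_)))

  count-false : ∀ k → count k (λ _ → false) ≡ 0
  count-false zero    = refl
  count-false (suc k) = trans (sum-cong-≗ {N} (λ _ → count-false k)) (sum-replicate-zero N)

  count-∧ˡ : ∀ k b (P : Vec (Fin N) k → Bool) → count k (λ xs → b ∧ P xs) ≡ (if b then count k P else 0)
  count-∧ˡ k true  P = refl
  count-∧ˡ k false P = count-false k

  count-head : ∀ k (w : Fin N) (P : Vec (Fin N) (suc k) → Bool) →
               count (suc k) (λ xs → ⌊ head xs ≟ w ⌋ ∧ P xs) ≡ count k (P ∘ (w ∷_))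
  count-head k w P = trans (sum-cong-≗ {N} (λ x → count-∧ˡ k ⌊ x ≟ w ⌋ (P ∘ (x ∷_)))) (∑-if-≟ w _)

parity→ℕ : Parity → ℕ
parity→ℕ 0ℙ = 0
parity→ℕ 1ℙ = 1

%2≡parity→ℕ : ∀ m → m % 2 ≡ parity→ℕ (parity m)
%2≡parity→ℕ zero          = refl
%2≡parity→ℕ (suc zero)    = refl
%2≡parity→ℕ (suc (suc m)) = trans (cong (_% 2) (+-comm 2 m)) (trans ([m+n]%n≡m%n m 2) (%2≡parity→ℕ m))

Odd⇔parity≡1ℙ : ∀ m → Odd m ⇔ parity m ≡ 1ℙ
Odd⇔parity≡1ℙ m rewrite %2≡parity→ℕ m with parity m
... | 0ℙ = mk⇔ (λ ()) (λ ())
... | 1ℙ = mk⇔ (λ _ → refl) (λ _ → refl)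

parity≡evenTest⁻¹ : ∀ m → parity m ≡ parity (if ⌊ m % 2 ℕ≟ 0 ⌋ then 1 else 0) ⁻¹
parity≡evenTest⁻¹ m rewrite %2≡parity→ℕ m with parity m
... | 0ℙ = refl
... | 1ℙ = refl

parity-∑ : ∀ {N} (f : Fin N → ℕ) → parity (∑[ x < N ] f x) ≡ ℙ∑.sum (parity ∘ f)
parity-∑ {zero}  f = refl
parity-∑ {suc N} f = trans (+-homo-+ (f zero) _) (cong (parity (f zero) ℙ.+_) (parity-∑ (f ∘ suc)))

∑-parity-cong : ∀ {N} (f g : Fin N → ℕ) → (∀ x → parity (f x) ≡ parity (g x)) →
                parity (∑[ x < N ] f x) ≡ parity (∑[ x < N ] g x)
∑-parity-cong {N} f g f≡g = begin
  parity (sum f)       ≡⟨ parity-∑ f ⟩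
  ℙ∑.sum (parity ∘ f)  ≡⟨ ℙ∑.sum-cong-≗ {N} f≡g ⟩
  ℙ∑.sum (parity ∘ g)  ≡⟨ parity-∑ g ⟨
  parity (sum g)       ∎
  where open ≡-Reasoning

∑-parity-split : ∀ {N} (f g h : Fin N → ℕ) → (∀ x → parity (f x) ≡ parity (g x) ℙ.+ parity (h x)) →
                 parity (∑[ x < N ] f x) ≡ parity (∑[ x < N ] g x) ℙ.+ parity (∑[ x < N ] h x)
∑-parity-split {N} f g h f≡g+h = begin
  parity (sum f)                                ≡⟨ parity-∑ f ⟩
  ℙ∑.sum (parity ∘ f)                           ≡⟨ ℙ∑.sum-cong-≗ {N} f≡g+h ⟩
  ℙ∑.sum (λ x → parity (g x) ℙ.+ parity (h x))  ≡⟨ ℙ∑.∑-distrib-+ (parity ∘ g) (parity ∘ h) ⟩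
  ℙ∑.sum (parity ∘ g) ℙ.+ ℙ∑.sum (parity ∘ h)   ≡⟨ cong₂ ℙ._+_ (parity-∑ g) (parity-∑ h) ⟨
  parity (sum g) ℙ.+ parity (sum h)             ∎
  where open ≡-Reasoning

T-injective : ∀ {a b} → (T a ⇔ T b) → a ≡ b
T-injective {false} {false} _   = refl
T-injective {false} {true}  a⇔b = ⊥-elim (Equivalence.from a⇔b tt)
T-injective {true}  {false} a⇔b = ⊥-elim (Equivalence.to a⇔b tt)
T-injective {true}  {true}  _   = refl

T-not-∨ : ∀ {a b} → T (not a ∨ b) ⇔ (T a → T b)
T-not-∨ {false} = mk⇔ (λ _ ()) (λ _ → tt)
T-not-∨ {true}  = mk⇔ (λ b _ → b) (λ a⇒b → a⇒b tt)

T-all-allFin : ∀ {k} (p : Fin k → Bool) → T (all p (allFin k)) ⇔ (∀ i → T (p i))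
T-all-allFin p = mk⇔ (λ t i → All.lookup (all⁺ p (allFin _) t) (∈-allFin i))
                     (λ f → all⁻ p {allFin _} (All.tabulate (λ {i} _ → f i)))

T-succB : ∀ {a b} → T (succB a b) ⇔ (suc a ≡ b)
T-succB = mk⇔ toWitness fromWitness

T-pathAdj : ∀ {k} (i j : Fin k) → T (pathAdj k i j) ⇔ (suc (toℕ i) ≡ toℕ j ⊎ suc (toℕ j) ≡ toℕ i)
T-pathAdj i j = mk⇔ (Sum.map (Equivalence.to T-succB) (Equivalence.to T-succB) ∘ Equivalence.to T-∨)
                    (Equivalence.from T-∨ ∘ Sum.map (Equivalence.from T-succB) (Equivalence.from T-succB))

module _ (H : Graph) where

  deg-∑ : ∀ v → deg H v ≡ ∑[ u < n H ] (if adj H v u then 1 else 0)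
  deg-∑ v = trans (cong List.sum (map-tabulate {n = n H} (λ u → u) indicator)) (sum-tabulate indicator)
    where
    indicator : Fin (n H) → ℕ
    indicator u = if adj H v u then 1 else 0

  walks : ℕ → Fin (n H) → ℕ
  walks m v = count m (λ xs → consecAdj H (v ∷ xs))

  walks-suc : ∀ m v → walks (suc m) v ≡ ∑[ u < n H ] (if adj H v u then walks m u else 0)
  walks-suc m v = sum-cong-≗ {n H} (λ u → count-∧ˡ m (adj H v u) _)

  walks-one : ∀ v → walks 1 v ≡ deg H v
  walks-one v = trans (walks-suc 0 v) (sym (deg-∑ v))

  parity-walks-suc : ∀ m u → (∀ z → T (adj H u z) → parity (walks m z) ≡ 1ℙ) →
                     parity (walks (suc m) u) ≡ parity (deg H u)
  parity-walks-suc m u odd-next = begin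
    parity (walks (suc m) u)                                      ≡⟨ cong parity (walks-suc m u) ⟩
    parity (∑[ z < n H ] (if adj H u z then walks m z else 0))    ≡⟨ ∑-parity-cong _ _ termwise ⟩
    parity (∑[ z < n H ] (if adj H u z then 1 else 0))            ≡⟨ cong parity (deg-∑ u) ⟨
    parity (deg H u)                                              ∎
    where
    open ≡-Reasoning
    termwise : ∀ z → parity (if adj H u z then walks m z else 0) ≡ parity (if adj H u z then 1 else 0)
    termwise z with adj H u z in u~z
    ... | true  = odd-next z (subst T (sym u~z) tt)
    ... | false = refl

  evenDeg : Fin (n H) → Bool
  evenDeg v = ⌊ deg H v % 2 ℕ≟ 0 ⌋

  fresh : Fin (n H) → List (Fin (n H)) → Bool
  fresh x []      = true
  fresh x (a ∷ A) = not ⌊ a ≟ x ⌋ ∧ fresh x A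

  fresh-∷-adj : ∀ {v u} A → T (adj H v u) → fresh u (v ∷ A) ≡ fresh u A
  fresh-∷-adj {v} {u} A v~u with v ≟ u
  ... | yes refl = ⊥-elim (subst T (irrefl H v) v~u)
  ... | no  _    = refl

  avoids : List (Fin (n H)) → ∀ {k} → Vec (Fin (n H)) k → Bool
  avoids []      ys = true
  avoids (a ∷ A) ys = notIn a ys ∧ avoids A ys

  avoids-[] : ∀ A → avoids A [] ≡ true
  avoids-[] []      = refl
  avoids-[] (a ∷ A) = avoids-[] A

  avoids-∷ : ∀ A y {k} (ys : Vec (Fin (n H)) k) → avoids A (y ∷ ys) ≡ fresh y A ∧ avoids A ys
  avoids-∷ []      y ys = refl
  avoids-∷ (a ∷ A) y ys =
    trans (cong ((not ⌊ a ≟ y ⌋ ∧ notIn a ys) ∧_) (avoids-∷ A y ys))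
          (solve 4 (λ p q s t → (p ⊕ q) ⊕ (s ⊕ t) ⊜ (p ⊕ s) ⊕ (q ⊕ t)) refl
                 (not ⌊ a ≟ y ⌋) (notIn a ys) (fresh y A) (avoids A ys))

  isEvenEndedPath : ∀ {k} → Vec (Fin (n H)) (suc k) → Bool
  isEvenEndedPath p = (consecAdj H p ∧ distinct p) ∧ evenDeg (last p)

  -- A lists the vertices visited before v, most recent first; v ∷ xs must continue that path
  -- without revisiting a vertex and end at a vertex of even degree.
  evenPathExt : List (Fin (n H)) → Fin (n H) → ∀ {m} → Vec (Fin (n H)) m → Bool
  evenPathExt A v []       = evenDeg v
  evenPathExt A v (x ∷ xs) = adj H v x ∧ (fresh x (v ∷ A) ∧ evenPathExt (v ∷ A) x xs)

  avoids∧isEvenEndedPath : ∀ A v {m} (xs : Vec (Fin (n H)) m) →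
                           avoids A (v ∷ xs) ∧ isEvenEndedPath (v ∷ xs) ≡ fresh v A ∧ evenPathExt A v xs
  avoids∧isEvenEndedPath A v [] = begin
    avoids A (v ∷ []) ∧ evenDeg v          ≡⟨ cong (_∧ evenDeg v) (avoids-∷ A v []) ⟩
    (fresh v A ∧ avoids A []) ∧ evenDeg v  ≡⟨ cong (λ b → (fresh v A ∧ b) ∧ evenDeg v) (avoids-[] A) ⟩
    (fresh v A ∧ true) ∧ evenDeg v         ≡⟨ cong (_∧ evenDeg v) (∧-identityʳ (fresh v A)) ⟩
    fresh v A ∧ evenDeg v                  ∎
    where open ≡-Reasoning
  avoids∧isEvenEndedPath A v (x ∷ xs) = begin
    avoids A (v ∷ x ∷ xs) ∧ isEvenEndedPath (v ∷ x ∷ xs)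
      ≡⟨ cong (_∧ isEvenEndedPath (v ∷ x ∷ xs)) (avoids-∷ A v (x ∷ xs)) ⟩
    (f ∧ av) ∧ (((a ∧ c) ∧ (nv ∧ d)) ∧ e)
      ≡⟨ solve 7 (λ f av a c nv d e → (f ⊕ av) ⊕ (((a ⊕ c) ⊕ (nv ⊕ d)) ⊕ e)
                                     ⊜ f ⊕ (a ⊕ ((nv ⊕ av) ⊕ ((c ⊕ d) ⊕ e)))) refl f av a c nv d e ⟩
    f ∧ (a ∧ (avoids (v ∷ A) (x ∷ xs) ∧ isEvenEndedPath (x ∷ xs)))
      ≡⟨ cong (λ b → f ∧ (a ∧ b)) (avoids∧isEvenEndedPath (v ∷ A) x xs) ⟩
    fresh v A ∧ evenPathExt A v (x ∷ xs) ∎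
    where
    open ≡-Reasoning
    f  = fresh v A
    av = avoids A (x ∷ xs)
    a  = adj H v x
    c  = consecAdj H (x ∷ xs)
    nv = notIn v (x ∷ xs)
    d  = distinct (x ∷ xs)
    e  = evenDeg (last (x ∷ xs))

  evenPaths : List (Fin (n H)) → ℕ → Fin (n H) → ℕ
  evenPaths A m v = count m (evenPathExt A v)

  evenPaths-suc : ∀ A m v → evenPaths A (suc m) v ≡
                  ∑[ u < n H ] (if adj H v u then (if fresh u (v ∷ A) then evenPaths (v ∷ A) m u else 0) else 0)
  evenPaths-suc A m v = sum-cong-≗ {n H} (λ u →
    trans (count-∧ˡ m (adj H v u) _) (cong (λ c → if adj H v u then c else 0) (count-∧ˡ m (fresh u (v ∷ A)) _)))

  count-evenEndedPaths : ∀ k w → count (suc k) (λ p → isPathFrom H w p ∧ evenDeg (last p)) ≡ evenPaths [] k w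
  count-evenEndedPaths k w = begin
    count (suc k) (λ p → isPathFrom H w p ∧ evenDeg (last p))
      ≡⟨ count-cong (suc k) (λ p → ∧-assoc ⌊ head p ≟ w ⌋ (consecAdj H p ∧ distinct p) (evenDeg (last p))) ⟩
    count (suc k) (λ p → ⌊ head p ≟ w ⌋ ∧ isEvenEndedPath p)
      ≡⟨ count-head k w isEvenEndedPath ⟩
    count k (isEvenEndedPath ∘ (w ∷_))
      ≡⟨ count-cong k (avoids∧isEvenEndedPath [] w) ⟩
    evenPaths [] k w ∎
    where open ≡-Reasoning

-- Homomorphisms from a path graph are walks

module _ (H : Graph) where

  StepsAdjacent : ∀ {k} → Vec (Fin (n H)) k → Set
  StepsAdjacent σ = ∀ i j → suc (toℕ i) ≡ toℕ j → T (adj H (lookup σ i) (lookup σ j))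

  T-consecAdj : ∀ {k} (σ : Vec (Fin (n H)) k) → T (consecAdj H σ) ⇔ StepsAdjacent σ
  T-consecAdj σ = mk⇔ (to σ) (from σ)
    where
    to : ∀ {k} (σ : Vec (Fin (n H)) k) → T (consecAdj H σ) → StepsAdjacent σ
    to (u ∷ [])     t zero    zero          ()
    to (u ∷ v ∷ vs) t zero    (suc zero)    _  = proj₁ (Equivalence.to T-∧ t)
    to (u ∷ v ∷ vs) t zero    (suc (suc j)) ()
    to (u ∷ v ∷ vs) t (suc i) zero          ()
    to (u ∷ v ∷ vs) t (suc i) (suc j)       e  = to (v ∷ vs) (proj₂ (Equivalence.to T-∧ t)) i j (suc-injective e)
    from : ∀ {k} (σ : Vec (Fin (n H)) k) → StepsAdjacent σ → T (consecAdj H σ)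
    from []           _     = tt
    from (u ∷ [])     _     = tt
    from (u ∷ v ∷ vs) steps =
      Equivalence.from T-∧ (steps zero (suc zero) refl , from (v ∷ vs) (λ i j e → steps (suc i) (suc j) (cong suc e)))

  isHom-pathGraph : ∀ k (σ : Vec (Fin (n H)) k) → isHom (pathGraph k) H σ ≡ consecAdj H σ
  isHom-pathGraph k σ = T-injective (mk⇔ hom⇒walk walk⇒hom)
    where
    T-isHom : T (isHom (pathGraph k) H σ) ⇔ (∀ i j → T (pathAdj k i j) → T (adj H (lookup σ i) (lookup σ j)))
    T-isHom = mk⇔
      (λ t i j → Equivalence.to T-not-∨ (Equivalence.to (T-all-allFin _) (Equivalence.to (T-all-allFin _) t i) j))
      (λ f → Equivalence.from (T-all-allFin _) (λ i → Equivalence.from (T-all-allFin _) (λ j → Equivalence.from T-not-∨ (f i j))))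
    hom⇒walk : T (isHom (pathGraph k) H σ) → T (consecAdj H σ)
    hom⇒walk t = Equivalence.from (T-consecAdj σ) λ i j i→j →
      Equivalence.to T-isHom t i j (Equivalence.from (T-pathAdj i j) (inj₁ i→j))
    walk⇒hom : T (consecAdj H σ) → T (isHom (pathGraph k) H σ)
    walk⇒hom t = Equivalence.from T-isHom λ i j ij → case Equivalence.to (T-pathAdj i j) ij of λ where
      (inj₁ i→j) → Equivalence.to (T-consecAdj σ) t i j i→j
      (inj₂ j→i) → subst T (symm H _ _) (Equivalence.to (T-consecAdj σ) t j i j→i)

  count-homs-pathGraph : ∀ k w →
    count (suc k) (λ σ → isHom (pathGraph (suc k)) H σ ∧ ⌊ lookup σ zero ≟ w ⌋) ≡ walks H k w
  count-homs-pathGraph k w = trans (count-cong (suc k) rooted-hom≡rooted-walk) (count-head k w (consecAdj H))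
    where
    rooted-hom≡rooted-walk : ∀ σ → isHom (pathGraph (suc k)) H σ ∧ ⌊ lookup σ zero ≟ w ⌋ ≡ ⌊ head σ ≟ w ⌋ ∧ consecAdj H σ
    rooted-hom≡rooted-walk σ@(x ∷ _) =
      trans (∧-comm (isHom (pathGraph (suc k)) H σ) ⌊ x ≟ w ⌋) (cong (⌊ x ≟ w ⌋ ∧_) (isHom-pathGraph (suc k) σ))

-- Paths from a fixed vertex, grown by appending fresh neighbours

≟-sym : ∀ {N} (x y : Fin N) → ⌊ x ≟ y ⌋ ≡ ⌊ y ≟ x ⌋
≟-sym x y with x ≟ y | y ≟ x
... | yes _    | yes _    = refl
... | no  _    | no  _    = refl
... | yes refl | no x≢x   = ⊥-elim (x≢x refl)
... | no  x≢y  | yes refl = ⊥-elim (x≢y refl)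

notIn-∷ʳ : ∀ {N k} (x : Fin N) (p : Vec (Fin N) k) z → notIn x (p ∷ʳ z) ≡ notIn x p ∧ not ⌊ x ≟ z ⌋
notIn-∷ʳ x []       z = ∧-identityʳ _
notIn-∷ʳ x (y ∷ ys) z =
  trans (cong (not ⌊ x ≟ y ⌋ ∧_) (notIn-∷ʳ x ys z)) (sym (∧-assoc (not ⌊ x ≟ y ⌋) (notIn x ys) (not ⌊ x ≟ z ⌋)))

distinct-∷ʳ : ∀ {N k} (p : Vec (Fin N) k) z → distinct (p ∷ʳ z) ≡ distinct p ∧ notIn z p
distinct-∷ʳ []       z = refl
distinct-∷ʳ (x ∷ xs) z = begin
  notIn x (xs ∷ʳ z) ∧ distinct (xs ∷ʳ z)
    ≡⟨ cong₂ _∧_ (notIn-∷ʳ x xs z) (distinct-∷ʳ xs z) ⟩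
  (notIn x xs ∧ not ⌊ x ≟ z ⌋) ∧ (distinct xs ∧ notIn z xs)
    ≡⟨ cong (λ b → (notIn x xs ∧ not b) ∧ (distinct xs ∧ notIn z xs)) (≟-sym x z) ⟩
  (notIn x xs ∧ not ⌊ z ≟ x ⌋) ∧ (distinct xs ∧ notIn z xs)
    ≡⟨ solve 4 (λ a b c d → (a ⊕ b) ⊕ (c ⊕ d) ⊜ (a ⊕ c) ⊕ (b ⊕ d)) refl
               (notIn x xs) (not ⌊ z ≟ x ⌋) (distinct xs) (notIn z xs) ⟩
  (notIn x xs ∧ distinct xs) ∧ (not ⌊ z ≟ x ⌋ ∧ notIn z xs) ∎
  where open ≡-Reasoning

module _ (H : Graph) (w : Fin (n H)) where

  consecAdj-∷ʳ : ∀ {k} (p : Vec (Fin (n H)) (suc k)) z → consecAdj H (p ∷ʳ z) ≡ consecAdj H p ∧ adj H (last p) z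
  consecAdj-∷ʳ (x ∷ [])     z = ∧-identityʳ _
  consecAdj-∷ʳ (x ∷ y ∷ ys) z =
    trans (cong (adj H x y ∧_) (consecAdj-∷ʳ (y ∷ ys) z)) (sym (∧-assoc (adj H x y) (consecAdj H (y ∷ ys)) (adj H (last (y ∷ ys)) z)))

  isPathFrom-∷ʳ : ∀ {k} (p : Vec (Fin (n H)) (suc k)) z →
                  isPathFrom H w (p ∷ʳ z) ≡ isPathFrom H w p ∧ (adj H (last p) z ∧ notIn z p)
  isPathFrom-∷ʳ p@(x ∷ xs) z = begin
    ⌊ x ≟ w ⌋ ∧ (consecAdj H (p ∷ʳ z) ∧ distinct (p ∷ʳ z))
      ≡⟨ cong₂ (λ c d → ⌊ x ≟ w ⌋ ∧ (c ∧ d)) (consecAdj-∷ʳ p z) (distinct-∷ʳ p z) ⟩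
    ⌊ x ≟ w ⌋ ∧ ((consecAdj H p ∧ adj H (last p) z) ∧ (distinct p ∧ notIn z p))
      ≡⟨ solve 5 (λ h c a d f → h ⊕ ((c ⊕ a) ⊕ (d ⊕ f)) ⊜ (h ⊕ (c ⊕ d)) ⊕ (a ⊕ f)) refl
                 ⌊ x ≟ w ⌋ (consecAdj H p) (adj H (last p) z) (distinct p) (notIn z p) ⟩
    isPathFrom H w p ∧ (adj H (last p) z ∧ notIn z p) ∎
    where open ≡-Reasoning

  data IsPathFromʳ : ∀ {l} → Vec (Fin (n H)) (suc l) → Set where
    [w]    : IsPathFromʳ (w ∷ [])
    extend : ∀ {l} {p : Vec (Fin (n H)) (suc l)} {z} →
             IsPathFromʳ p → T (adj H (last p) z) → T (notIn z p) → IsPathFromʳ (p ∷ʳ z)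

  IsPathFromʳ⇒isPathFrom : ∀ {l} {p : Vec (Fin (n H)) (suc l)} → IsPathFromʳ p → T (isPathFrom H w p)
  IsPathFromʳ⇒isPathFrom [w] = Equivalence.from T-∧ (fromWitness refl , tt)
  IsPathFromʳ⇒isPathFrom (extend {p = p} {z} path p~z z∉p) =
    subst T (sym (isPathFrom-∷ʳ p z))
      (Equivalence.from T-∧ (IsPathFromʳ⇒isPathFrom path , Equivalence.from T-∧ (p~z , z∉p)))

  record PathWithin (k : ℕ) (y : Fin (n H)) : Set where
    constructor pathWithin
    field
      {len}    : ℕ
      len≤k    : len ≤ k
      vertices : Vec (Fin (n H)) (suc len)
      isPath   : IsPathFromʳ vertices
      endsAt   : last vertices ≡ y

  pathWithin-≤ : ∀ {k k′ y} → k ≤ k′ → PathWithin k y → PathWithin k′ y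
  pathWithin-≤ k≤k′ (pathWithin l≤k p path end) = pathWithin (≤-trans l≤k k≤k′) p path end

  pathWithin-start : ∀ {k} → PathWithin k w
  pathWithin-start = pathWithin z≤n (w ∷ []) [w] refl

  truncate : ∀ {l} {p : Vec (Fin (n H)) (suc l)} {z} → IsPathFromʳ p → notIn z p ≡ false → PathWithin l z
  truncate {z = z} [w] z∈p with z ≟ w
  ... | yes refl = pathWithin-start
  truncate {z = z} (extend {p = p} {y} path p~y y∉p) z∈p with z ≟ y | notIn-∷ʳ z p y
  ... | yes refl | _     = pathWithin ≤-refl (p ∷ʳ z) (extend path p~y y∉p) (last-∷ʳ z p)
  ... | no  _    | split = pathWithin-≤ (n≤1+n _) (truncate path (trans (sym (∧-identityʳ _)) (trans (sym split) z∈p)))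

  -- A neighbour z of the end of a path is either new (extend) or already on it (truncate there).
  pathWithin-step : ∀ {k y z} → PathWithin k y → T (adj H y z) → PathWithin (suc k) z
  pathWithin-step {z = z} (pathWithin l≤k p path refl) y~z with notIn z p in z∉p
  ... | true  = pathWithin (s≤s l≤k) (p ∷ʳ z) (extend path y~z (subst T (sym z∉p) tt)) (last-∷ʳ z p)
  ... | false = pathWithin-≤ (≤-trans l≤k (n≤1+n _)) (truncate path z∉p)

  pathWithin⇒WithinDistPred : ∀ {k y} r → PathWithin k y → k < r → WithinDistPred H w y r
  pathWithin⇒WithinDistPred r (pathWithin l≤k p path end) k<r =
    _ , ≤-trans (s≤s l≤k) k<r , (p , IsPathFromʳ⇒isPathFrom path) , end

-- The parity induction

module _ (H : Graph) (w : Fin (n H)) (r : ℕ)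
         (odd-near : ∀ {k y} → PathWithin H w k y → k < r → parity (deg H y) ≡ 1ℙ) where

  walks-odd : ∀ m {k u} → PathWithin H w k u → k + m < r → parity (walks H (suc m) u) ≡ 1ℙ
  walks-odd zero {k} {u} reach k+0<r =
    trans (parity-walks-suc H 0 u (λ _ _ → refl)) (odd-near reach (≤-trans (s≤s (m≤m+n k 0)) k+0<r))
  walks-odd (suc m) {k} {u} reach k+1+m<r =
    trans (parity-walks-suc H (suc m) u odd-next) (odd-near reach (≤-trans (s≤s (m≤m+n k (suc m))) k+1+m<r))
    where
    odd-next : ∀ z → T (adj H u z) → parity (walks H (suc m) z) ≡ 1ℙ
    odd-next z u~z = walks-odd m (pathWithin-step H w reach u~z) (subst (_< r) (+-suc k m) k+1+m<r)

  CloserThan : ℕ → List (Fin (n H)) → Set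
  CloserThan j A = ∀ u → fresh H u A ≡ false → Σ ℕ λ i → i < j × PathWithin H w i u

  closerThan-∷ : ∀ {j v A} → PathWithin H w j v → CloserThan j A → CloserThan (suc j) (v ∷ A)
  closerThan-∷ {j} {v} reach closer u u∉vA with v ≟ u
  ... | yes refl = j , ≤-refl , reach
  ... | no  _    with closer u u∉vA
  ...   | i , i<j , reach-u = i , ≤-trans i<j (n≤1+n j) , reach-u

  walks≡evenPaths⁻¹ : ∀ m {j} A v → j + m ≡ r → PathWithin H w j v → CloserThan j A →
                      parity (walks H (suc m) v) ≡ parity (evenPaths H A m v) ⁻¹
  walks≡evenPaths⁻¹ zero A v _ _ _ = trans (cong parity (walks-one H v)) (parity≡evenTest⁻¹ (deg H v))
  walks≡evenPaths⁻¹ (suc m) {j} A v j+1+m≡r reach closer = begin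
    parity (walks H (suc (suc m)) v)
      ≡⟨ cong parity (walks-suc H (suc m) v) ⟩
    parity (∑[ u < n H ] (if adj H v u then walks H (suc m) u else 0))
      ≡⟨ ∑-parity-split _ _ _ termwise ⟩
    parity (∑[ u < n H ] (if adj H v u then 1 else 0)) ℙ.+ parity (∑[ u < n H ] continuations u)
      ≡⟨ cong₂ ℙ._+_ (trans (cong parity (sym (deg-∑ H v))) (odd-near reach j<r)) (cong parity (sym (evenPaths-suc H A m v))) ⟩
    parity (evenPaths H A (suc m) v) ⁻¹ ∎
    where
    open ≡-Reasoning
    1+j+m≡r : suc j + m ≡ r
    1+j+m≡r = trans (sym (+-suc j m)) j+1+m≡r
    j+m<r : j + m < r
    j+m<r = ≤-reflexive 1+j+m≡r
    j<r : j < r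
    j<r = ≤-trans (s≤s (m≤m+n j m)) j+m<r
    continuations : Fin (n H) → ℕ
    continuations u = if adj H v u then (if fresh H u (v ∷ A) then evenPaths H (v ∷ A) m u else 0) else 0
    visited-odd : ∀ {u} → fresh H u A ≡ false → parity (walks H (suc m) u) ≡ 1ℙ
    visited-odd u∈A with closer _ u∈A
    ... | i , i<j , reach-u = walks-odd m reach-u (≤-trans (+-monoˡ-≤ m i<j) (≤-trans (n≤1+n (j + m)) j+m<r))
    termwise : ∀ u → parity (if adj H v u then walks H (suc m) u else 0) ≡
                     parity (if adj H v u then 1 else 0) ℙ.+ parity (continuations u)
    termwise u with adj H v u in v~u
    ... | false = refl
    ... | true with fresh H u (v ∷ A) in u-fresh
    ...   | true  = walks≡evenPaths⁻¹ m (v ∷ A) u 1+j+m≡r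
                      (pathWithin-step H w reach (subst T (sym v~u) tt)) (closerThan-∷ {A = A} reach closer)
    ...   | false = visited-odd (trans (sym (fresh-∷-adj H A (subst T (sym v~u) tt))) u-fresh)

lemma5p6 : (H : Graph) (r : ℕ) (w : Fin (n H)) →
    (∀ v → WithinDistPred H w v r → Odd (deg H v)) →
    (h e : ℕ) → Hom (pathGraph (suc (suc r))) zero H w ↔ Fin h →
    EvenEndPath H w r ↔ Fin e →
    Odd (h + e)
lemma5p6 H r w odd-within h e Hom↔h EvenEnd↔e = Equivalence.from (Odd⇔parity≡1ℙ (h + e)) (begin
  parity (h + e)                                                         ≡⟨ +-homo-+ h e ⟩
  parity h ℙ.+ parity e                                                  ≡⟨ cong₂ (λ a b → parity a ℙ.+ parity b) h≡walks e≡evenPaths ⟩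
  parity (walks H (suc r) w) ℙ.+ parity (evenPaths H [] r w)             ≡⟨ cong (ℙ._+ parity (evenPaths H [] r w)) walks≡evenPaths⁻¹-at-w ⟩
  parity (evenPaths H [] r w) ⁻¹ ℙ.+ parity (evenPaths H [] r w)         ≡⟨ p⁻¹+p≡1ℙ (parity (evenPaths H [] r w)) ⟩
  1ℙ                                                                     ∎)
  where
  open ≡-Reasoning
  h≡walks : h ≡ walks H (suc r) w
  h≡walks = trans (↔Fin-unique Hom↔h (Σ-Vec↔Fin-count (suc (suc r)) _)) (count-homs-pathGraph H (suc r) w)
  e≡evenPaths : e ≡ evenPaths H [] r w
  e≡evenPaths = trans (↔Fin-unique EvenEnd↔e (Σ-Vec↔Fin-count (suc r) _)) (count-evenEndedPaths H r w)
  odd-near : ∀ {k y} → PathWithin H w k y → k < r → parity (deg H y) ≡ 1ℙ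
  odd-near {y = y} reach k<r = Equivalence.to (Odd⇔parity≡1ℙ (deg H y)) (odd-within y (pathWithin⇒WithinDistPred H w r reach k<r))
  walks≡evenPaths⁻¹-at-w : parity (walks H (suc r) w) ≡ parity (evenPaths H [] r w) ⁻¹
  walks≡evenPaths⁻¹-at-w = walks≡evenPaths⁻¹ H w r odd-near r [] w refl (pathWithin-start H w) (λ _ ())
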